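{- Let $G=(V,E)$ be a finite simple undirected graph and $c$ a (proper) coloring of $G$, and let $i$ be the largest color used by $c$ (i.e. the largest integer with $c^{ -1}(i)\neq\emptyset$). Then $\gamma_{uc}(G,c)\geq \max\{|c^{ -1}(i)|,\gamma(G)\}$.
   Context: A coloring of $G$ is a map $c:V\to\{0,1,2,\dots\}$ with $c(u)\neq c(v)$ whenever $u,v$ are adjacent. Given $(G,c)$, a set $D\subseteq V$ is an up--color dominating $c$--set if (1) every vertex $v\notin D$ has a neighbor $d\in D$ with $c(v)<c(d)$, and (2) $D$ contains no vertex of color $0$. $\gamma_{uc}(G,c)$ is the minimum cardinality of an up--color dominating $c$--set. $\gamma(G)$ is the domination number of $G$. -}

module Defs where

open import Data.Nat using (ℕ; _≤_; _<_)
open import Data.Fin using (Fin)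
open import Data.Fin.Subset using (Subset; _∈_; _∉_; ∣_∣)
open import Data.Vec using (tabulate)
open import Data.Bool using (Bool)
open import Data.Product using (Σ; _×_; ∃)
open import Relation.Nullary using (¬_; Dec; does)
open import Relation.Binary.PropositionalEquality using (_≡_)
open import Data.Nat using (_≟_)

record Graph (n : ℕ) : Set₁ where
  field
    Adj     : Fin n → Fin n → Set
    adj?    : (u v : Fin n) → Dec (Adj u v)
    irrefl  : ∀ v → ¬ Adj v v
    sym     : ∀ {u v} → Adj u v → Adj v u
open Graph public

IsColoring : ∀ {n} → Graph n → (Fin n → ℕ) → Set
IsColoring G c = ∀ u v → Adj G u v → ¬ (c u ≡ c v)

IsDominating : ∀ {n} → Graph n → Subset n → Set
IsDominating G D = ∀ v → v ∉ D → ∃ λ d → d ∈ D × Adj G v d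

IsDominationNumber : ∀ {n} → Graph n → ℕ → Set
IsDominationNumber G k =
  (Σ (Subset _) λ D → IsDominating G D × ∣ D ∣ ≡ k) ×
  (∀ D → IsDominating G D → k ≤ ∣ D ∣)

IsUpColorDominating : ∀ {n} → Graph n → (Fin n → ℕ) → Subset n → Set
IsUpColorDominating G c D =
  (∀ v → v ∉ D → ∃ λ d → d ∈ D × Adj G v d × c v < c d) ×
  (∀ v → v ∈ D → ¬ (c v ≡ 0))

IsUpColorDominationNumber : ∀ {n} → Graph n → (Fin n → ℕ) → ℕ → Set
IsUpColorDominationNumber G c m =
  (Σ (Subset _) λ D → IsUpColorDominating G c D × ∣ D ∣ ≡ m) ×
  (∀ D → IsUpColorDominating G c D → m ≤ ∣ D ∣)

IsMaxColor : ∀ {n} → (Fin n → ℕ) → ℕ → Set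
IsMaxColor c i = (∃ λ v → c v ≡ i) × (∀ v → c v ≤ i)

colorClass : ∀ {n} → (Fin n → ℕ) → ℕ → Subset n
colorClass c i = tabulate λ v → does (c v ≟ i)

{-# OPTIONS --safe #-}
module Submission where

open import Defs hiding (sym)
open import Data.Nat using (ℕ; _≤_; _⊔_)
open import Data.Nat.Properties using (⊔-lub; <⇒≱; ≡ᵇ⇒≡)
open import Data.Bool.Properties using (T-≡)
open import Function.Bundles using (module Equivalence)
open import Data.Fin using (Fin)
open import Data.Fin.Subset using (∣_∣; _∈_; _⊆_)
open import Data.Fin.Subset.Properties using (p⊆q⇒∣p∣≤∣q∣; _∈?_)
open import Data.Vec.Properties using ([]=⇒lookup; lookup∘tabulate)
open import Data.Product using (_,_)
open import Relation.Nullary using (yes; no; contradiction)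
open import Relation.Binary.PropositionalEquality using (_≡_; refl; sym; trans; subst)

-- Every up-color dominating set is dominating, so γ ≤ γ_uc. A vertex of the
-- largest colour has no neighbour of larger colour, so it cannot be
-- up-dominated and lies in every up-color dominating set: c⁻¹(i) ⊆ D.

module _ {n} (G : Graph n) (c : Fin n → ℕ) where

  upColorDominating⇒dominating : ∀ {D} → IsUpColorDominating G c D → IsDominating G D
  upColorDominating⇒dominating (up , _) v v∉D with up v v∉D
  ... | d , d∈D , v~d , _ = d , d∈D , v~d

  upColorDominating-maxColor∈ : ∀ {D x} → (∀ v → c v ≤ c x) → IsUpColorDominating G c D → x ∈ D
  upColorDominating-maxColor∈ {D} {x} c≤cx (up , _) with x ∈? D
  ... | yes x∈D = x∈D
  ... | no x∉D with up x x∉D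
  ...   | d , _ , _ , cx<cd = contradiction (c≤cx d) (<⇒≱ cx<cd)

  ∈-colorClass⇒≡ : ∀ {i x} → x ∈ colorClass c i → c x ≡ i
  -- does (c x ≟ i) computes to c x ≡ᵇ i.
  ∈-colorClass⇒≡ {i} {x} x∈ci =
    ≡ᵇ⇒≡ (c x) i (Equivalence.from T-≡ (trans (sym (lookup∘tabulate _ x)) ([]=⇒lookup x∈ci)))

  maxColorClass⊆upColorDominating : ∀ {D i} → (∀ v → c v ≤ i) → IsUpColorDominating G c D →
    colorClass c i ⊆ D
  maxColorClass⊆upColorDominating c≤i D-upc x∈ci =
    upColorDominating-maxColor∈ (subst (λ k → ∀ v → c v ≤ k) (sym (∈-colorClass⇒≡ x∈ci)) c≤i) D-upc

lemma1 : ∀ {n} (G : Graph n) (c : Fin n → ℕ) → IsColoring G c →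
    (i : ℕ) → IsMaxColor c i →
    (γ γuc : ℕ) → IsDominationNumber G γ → IsUpColorDominationNumber G c γuc →
    ∣ colorClass c i ∣ ⊔ γ ≤ γuc
lemma1 G c _ i (_ , c≤i) γ γuc (_ , γ-minimal) ((D , D-upc , refl) , _) =
  ⊔-lub (p⊆q⇒∣p∣≤∣q∣ (maxColorClass⊆upColorDominating G c c≤i D-upc))
        (γ-minimal D (upColorDominating⇒dominating G c D-upc))
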